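{- Let $G$ be a graph, $\mathcal{P}$ a maximal $P_2$-packing of $G$ of size $j$, suppose $G$ has a $P_2$-packing of size $j+1$, and let $\mathcal{Q}\in\mathfrak{Q}_{(2)}$. If $q=q_1q_2q_3\in\mathcal{Q}$ is shiftable on $p\in\mathcal{P}$ with respect to $q_1$ (respectively $q_3$), then there is some $p'\in\mathcal{P}$ with $p'\neq p$ such that $\{q_3,q_2\}\in E(p')$ (respectively $\{q_2,q_1\}\in E(p')$).
   Context: A $P_2$ is a path $p=p_1p_2p_3$ (three vertices, edges $p_1p_2$, $p_2p_3$; the roles of $p_1,p_3$ may be interchanged). A $P_2$-packing is a set of pairwise vertex-disjoint $P_2$'s in $G$, maximal if no further $P_2$ vertex-disjoint from all members can be added. $V(\cdot)$, $E(\cdot)$ denote vertex/edge sets (unions for sets of paths). $\mathfrak{Q}_{(1)}$ is the set of $P_2$-packings $\mathcal{Q}$ of size $j+1$ maximizing $\sum_{p\in\mathcal{P}}\sum_{q\in\mathcal{Q}}1_{[E(p)=E(q)]}$; $\mathfrak{Q}_{(2)}$ is the set of those $\mathcal{Q}\in\mathfrak{Q}_{(1)}$ maximizing $\sum_{p\in\mathcal{P}}\sum_{q\in\mathcal{Q}}|E(p)\cap E(q)|$. A path $q=q_1q_2q_3\in\mathcal{Q}$ is shiftable with respect to $q_1$ (resp. $q_3$) on $p=p_1p_2p_3\in\mathcal{P}$ if $q_1\in V(p)\cap V(q)$ (resp. $q_3\in V(p)\cap V(q)$) and, writing $p_s=q_1$ (resp. $p_s=q_3$) with $s\in\{1,2,3\}$,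 either $p_{s+1}$ exists and $p_{s+1}\notin V(\mathcal{Q})$, or $p_{s-1}$ exists and $p_{s-1}\notin V(\mathcal{Q})$. -}

module Defs where

open import Data.Nat using (ℕ; zero; suc; _+_; _≤_)
open import Data.Fin using (Fin; zero; suc; toℕ)
open import Data.Fin.Properties using (_≟_)
open import Data.Bool using (Bool; true; false; _∧_; _∨_; if_then_else_)
open import Data.List using (List; []; _∷_; length; map)
open import Data.Nat.ListAction using (sum)
open import Data.List.Membership.Propositional using (_∈_; _∉_)
open import Data.List.Relation.Unary.All using (All)
open import Data.List.Relation.Unary.AllPairs using (AllPairs)
open import Data.Product using (Σ; _×_; _,_; ∃)
open import Data.Sum using (_⊎_)
open import Relation.Nullary using (¬_; Dec)
open import Relation.Nullary.Decidable using (⌊_⌋)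
open import Relation.Binary.PropositionalEquality using (_≡_; _≢_)

record Graph (n : ℕ) : Set₁ where
  field
    Adj    : Fin n → Fin n → Set
    sym    : ∀ {u v} → Adj u v → Adj v u
    irrefl : ∀ {u} → ¬ Adj u u
    adj?   : ∀ u v → Dec (Adj u v)
open Graph public

-- A (candidate) P₂: three vertices p₁ p₂ p₃, edges p₁p₂ and p₂p₃.
record P2 (n : ℕ) : Set where
  constructor ⟨_,_,_⟩
  field
    v₁ v₂ v₃ : Fin n
open P2 public

-- vertex p_s, indexed by s ∈ {1,2,3} represented as Fin 3 = {0,1,2}
vtx : ∀ {n} → P2 n → Fin 3 → Fin n
vtx p zero = v₁ p
vtx p (suc zero) = v₂ p
vtx p (suc (suc zero)) = v₃ p

IsP2 : ∀ {n} → Graph n → P2 n → Set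
IsP2 G p = (v₁ p ≢ v₂ p) × (v₂ p ≢ v₃ p) × (v₁ p ≢ v₃ p)
         × Adj G (v₁ p) (v₂ p) × Adj G (v₂ p) (v₃ p)

_∈V_ : ∀ {n} → Fin n → P2 n → Set
x ∈V p = (x ≡ v₁ p) ⊎ (x ≡ v₂ p) ⊎ (x ≡ v₃ p)

_∈VS_ : ∀ {n} → Fin n → List (P2 n) → Set
x ∈VS Q = Σ _ λ q → (q ∈ Q) × (x ∈V q)

_∉VS_ : ∀ {n} → Fin n → List (P2 n) → Set
x ∉VS Q = ¬ (x ∈VS Q)

Disjoint : ∀ {n} → P2 n → P2 n → Set
Disjoint p q = ∀ x → x ∈V p → ¬ (x ∈V q)

-- a P₂-packing: a set (list) of pairwise vertex-disjoint P₂'s of G;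
-- its size is the length of the list (pairwise disjointness forces
-- the entries to be distinct, so this is the cardinality of the set).
IsPacking : ∀ {n} → Graph n → List (P2 n) → Set
IsPacking G P = All (IsP2 G) P × AllPairs Disjoint P

IsMaximalPacking : ∀ {n} → Graph n → List (P2 n) → Set
IsMaximalPacking G P =
  IsPacking G P × (∀ p → IsP2 G p → ¬ All (Disjoint p) P)

EdgeEq : ∀ {n} → (Fin n × Fin n) → (Fin n × Fin n) → Set
EdgeEq (u , v) (x , y) = ((u ≡ x) × (v ≡ y)) ⊎ ((u ≡ y) × (v ≡ x))

_∈E_ : ∀ {n} → (Fin n × Fin n) → P2 n → Set
e ∈E p = EdgeEq e (v₁ p , v₂ p) ⊎ EdgeEq e (v₂ p , v₃ p)

edgeEqᵇ : ∀ {n} → (Fin n × Fin n) → (Fin n × Fin n) → Bool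
edgeEqᵇ (u , v) (x , y) =
  (⌊ u ≟ x ⌋ ∧ ⌊ v ≟ y ⌋) ∨ (⌊ u ≟ y ⌋ ∧ ⌊ v ≟ x ⌋)

_∈Eᵇ_ : ∀ {n} → (Fin n × Fin n) → P2 n → Bool
e ∈Eᵇ p = edgeEqᵇ e (v₁ p , v₂ p) ∨ edgeEqᵇ e (v₂ p , v₃ p)

edges : ∀ {n} → P2 n → List (Fin n × Fin n)
edges p = (v₁ p , v₂ p) ∷ (v₂ p , v₃ p) ∷ []

allᵇ : ∀ {A : Set} → (A → Bool) → List A → Bool
allᵇ f [] = true
allᵇ f (x ∷ xs) = f x ∧ allᵇ f xs

count : ∀ {A : Set} → (A → Bool) → List A → ℕ
count f [] = 0
count f (x ∷ xs) = (if f x then 1 else 0) + count f xs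

sameEdges : ∀ {n} → P2 n → P2 n → ℕ
sameEdges p q =
  if allᵇ (_∈Eᵇ q) (edges p) ∧ allᵇ (_∈Eᵇ p) (edges q) then 1 else 0

commonEdges : ∀ {n} → P2 n → P2 n → ℕ
commonEdges p q = count (_∈Eᵇ q) (edges p)

double-sum : ∀ {n} → (P2 n → P2 n → ℕ) → List (P2 n) → List (P2 n) → ℕ
double-sum f P Q = sum (map (λ p → sum (map (f p) Q)) P)

score₁ score₂ : ∀ {n} → List (P2 n) → List (P2 n) → ℕ
score₁ = double-sum sameEdges
score₂ = double-sum commonEdges

InQ1 : ∀ {n} → Graph n → List (P2 n) → ℕ → List (P2 n) → Set
InQ1 G P j Q =
  IsPacking G Q × length Q ≡ suc j ×
  (∀ Q' → IsPacking G Q' → length Q' ≡ suc j → score₁ P Q' ≤ score₁ P Q)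

InQ2 : ∀ {n} → Graph n → List (P2 n) → ℕ → List (P2 n) → Set
InQ2 G P j Q =
  InQ1 G P j Q × (∀ Q' → InQ1 G P j Q' → score₂ P Q' ≤ score₂ P Q)

ShiftableAt : ∀ {n} → List (P2 n) → P2 n → P2 n → Fin n → Set
ShiftableAt Q q p x =
  x ∈V q ×
  Σ (Fin 3) λ s → (vtx p s ≡ x) ×
    ((Σ (Fin 3) λ t → (toℕ t ≡ suc (toℕ s)) × (vtx p t ∉VS Q))
     ⊎ (Σ (Fin 3) λ t → (suc (toℕ t) ≡ toℕ s) × (vtx p t ∉VS Q)))

module Submission where

-- Then q₁ has a neighbour y on p that no path of 𝒬 uses, and the path q' = y q₁ q₂
-- may replace q in 𝒬: the result is again a packing of size j+1.  If no member of 𝒫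
-- contained the edge {q₃,q₂}, this replacement would keep every term 1[E(p')=E(q)]
-- of score₁ (they all vanish) and every term |E(p') ∩ E(q)| of score₂ (the edge
-- {q₁,q₂} survives, {q₂,q₃} is counted nowhere), while |E(p) ∩ E(·)| strictly grows
-- by the edge {y,q₁}; this contradicts 𝒬 ∈ 𝔔₍₂₎.  Moreover {q₃,q₂} ∉ E(p), because
-- the middle vertex of p is q₁ or y.  The case of q₃ is the same argument applied to
-- the reversed path q₃q₂q₁.

open import Defs hiding (sym)
open import Data.Nat using (ℕ; suc; _≤_; _<_; z≤n; s≤s)
open import Data.Nat.Properties using (≤-refl; ≤-trans; ≤-reflexive; +-mono-≤; +-mono-<-≤; +-mono-≤-<; <⇒≱)
open import Data.Fin using (Fin; zero; suc; toℕ)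
open import Data.Fin.Properties using (_≟_)
open import Data.Bool using (Bool; true; false; T; if_then_else_)
open import Data.Bool.Properties using (T-∧; T-∨)
open import Data.Unit using (tt)
open import Data.List using (List; []; _∷_; length; map)
open import Data.List.Properties using (length-∷=)
open import Data.Nat.ListAction using (sum)
open import Data.List.Membership.Propositional using (_∈_; find; lose)
open import Data.List.Relation.Unary.Any using (Any; here; there; _∷=_; any?)
open import Data.List.Relation.Unary.All using (All; _∷_)
import Data.List.Relation.Unary.All as All
open import Data.List.Relation.Unary.AllPairs using (AllPairs; _∷_)
open import Data.Product using (Σ; _×_; _,_; proj₁; proj₂)
open import Data.Sum using (_⊎_; inj₁; inj₂)
open import Data.Empty using (⊥-elim)
open import Function using (_∘_; _⇔_; mk⇔; Equivalence)
open import Function.Properties.Equivalence using () renaming (trans to ⇔-trans)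
open import Data.Sum.Function.Propositional using (_⊎-⇔_)
open import Data.Product.Function.NonDependent.Propositional using (_×-⇔_)
open import Relation.Nullary using (¬_; Dec; yes; no)
open import Relation.Nullary.Decidable using (⌊_⌋; T?; toWitness; fromWitness)
import Relation.Nullary.Decidable as Dec
open import Relation.Binary.PropositionalEquality using (_≡_; _≢_; refl; sym; trans; subst)

indicator-mono : ∀ {b c : Bool} → (T b → T c) → (if b then 1 else 0) ≤ (if c then 1 else 0)
indicator-mono {false} _ = z≤n
indicator-mono {true} {true} _ = ≤-refl
indicator-mono {true} {false} b⇒c = ⊥-elim (b⇒c tt)

indicator-zero : ∀ {b : Bool} → ¬ T b → (if b then 1 else 0) ≡ 0
indicator-zero {false} _ = refl
indicator-zero {true} ¬b = ⊥-elim (¬b tt)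

indicator-strict : ∀ {b c : Bool} → ¬ T b → T c → (if b then 1 else 0) < (if c then 1 else 0)
indicator-strict {false} {true} _ _ = s≤s z≤n
indicator-strict {true} ¬b _ = ⊥-elim (¬b tt)

module _ {A : Set} where

  count-mono : (f g : A → Bool) (L : List A) → (∀ {x} → x ∈ L → T (f x) → T (g x)) →
               count f L ≤ count g L
  count-mono f g [] _ = z≤n
  count-mono f g (x ∷ L) f⇒g = +-mono-≤ (indicator-mono (f⇒g (here refl))) (count-mono f g L (f⇒g ∘ there))

  count-strict : (f g : A → Bool) (L : List A) → (∀ {x} → x ∈ L → T (f x) → T (g x)) →
                 ∀ {y} → y ∈ L → ¬ T (f y) → T (g y) → count f L < count g L
  count-strict f g (x ∷ L) f⇒g (here refl) ¬fy gy =
    +-mono-<-≤ (indicator-strict ¬fy gy) (count-mono f g L (f⇒g ∘ there))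
  count-strict f g (x ∷ L) f⇒g (there y∈L) ¬fy gy =
    +-mono-≤-< (indicator-mono (f⇒g (here refl))) (count-strict f g L (f⇒g ∘ there) y∈L ¬fy gy)

  allᵇ-lookup : (f : A → Bool) (L : List A) → T (allᵇ f L) → ∀ {x} → x ∈ L → T (f x)
  allᵇ-lookup f (x ∷ L) all-f (here refl) = proj₁ (Equivalence.to T-∧ all-f)
  allᵇ-lookup f (x ∷ L) all-f (there x∈L) = allᵇ-lookup f L (proj₂ (Equivalence.to T-∧ all-f)) x∈L

  sum-mono : (f g : A → ℕ) (L : List A) → (∀ {x} → x ∈ L → f x ≤ g x) →
             sum (map f L) ≤ sum (map g L)
  sum-mono f g [] _ = z≤n
  sum-mono f g (x ∷ L) f≤g = +-mono-≤ (f≤g (here refl)) (sum-mono f g L (f≤g ∘ there))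

  sum-strict : (f g : A → ℕ) (L : List A) → (∀ {x} → x ∈ L → f x ≤ g x) →
               ∀ {y} → y ∈ L → f y < g y → sum (map f L) < sum (map g L)
  sum-strict f g (x ∷ L) f≤g (here refl) fy<gy = +-mono-<-≤ fy<gy (sum-mono f g L (f≤g ∘ there))
  sum-strict f g (x ∷ L) f≤g (there y∈L) fy<gy =
    +-mono-≤-< (f≤g (here refl)) (sum-strict f g L (f≤g ∘ there) y∈L fy<gy)

  sum-∷=-mono : (h : A → ℕ) {y : A} (L : List A) (y∈L : y ∈ L) (y' : A) → h y ≤ h y' →
                sum (map h L) ≤ sum (map h (y∈L ∷= y'))
  sum-∷=-mono h (x ∷ L) (here refl) y' le = +-mono-≤ le ≤-refl
  sum-∷=-mono h (x ∷ L) (there y∈L) y' le = +-mono-≤ (≤-refl {h x}) (sum-∷=-mono h L y∈L y' le)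

  sum-∷=-strict : (h : A → ℕ) {y : A} (L : List A) (y∈L : y ∈ L) (y' : A) → h y < h y' →
                  sum (map h L) < sum (map h (y∈L ∷= y'))
  sum-∷=-strict h (x ∷ L) (here refl) y' lt = +-mono-<-≤ lt ≤-refl
  sum-∷=-strict h (x ∷ L) (there y∈L) y' lt = +-mono-≤-< (≤-refl {h x}) (sum-∷=-strict h L y∈L y' lt)

  All-∷= : {R : A → Set} {y : A} (L : List A) (y∈L : y ∈ L) (y' : A) →
           All R L → R y' → All R (y∈L ∷= y')
  All-∷= (x ∷ L) (here _) y' (_ ∷ rs) ry' = ry' ∷ rs
  All-∷= (x ∷ L) (there y∈L) y' (rx ∷ rs) ry' = rx ∷ All-∷= L y∈L y' rs ry'

  AllPairs-∷= : {R : A → A → Set} {y : A} (L : List A) (y∈L : y ∈ L) (y' : A) → AllPairs R L →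
    (∀ {x} → x ∈ L → R x y → R x y') → (∀ {x} → x ∈ L → R y x → R y' x) →
    AllPairs R (y∈L ∷= y')
  AllPairs-∷= (x ∷ L) (here refl) y' (rs ∷ rss) _ right =
    All.tabulate (λ x∈L → right (there x∈L) (All.lookup rs x∈L)) ∷ rss
  AllPairs-∷= (x ∷ L) (there y∈L) y' (rs ∷ rss) left right =
    All-∷= L y∈L y' rs (left (here refl) (All.lookup rs y∈L)) ∷
    AllPairs-∷= L y∈L y' rss (left ∘ there) (right ∘ there)

module _ {n : ℕ} where

  ≟-reflects : {u x : Fin n} → T ⌊ u ≟ x ⌋ ⇔ (u ≡ x)
  ≟-reflects = mk⇔ toWitness fromWitness

  edgeEqᵇ-reflects : {e f : Fin n × Fin n} → T (edgeEqᵇ e f) ⇔ EdgeEq e f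
  edgeEqᵇ-reflects =
    ⇔-trans T-∨ (⇔-trans T-∧ (≟-reflects ×-⇔ ≟-reflects) ⊎-⇔ ⇔-trans T-∧ (≟-reflects ×-⇔ ≟-reflects))

  ∈Eᵇ-reflects : {e : Fin n × Fin n} {p : P2 n} → T (e ∈Eᵇ p) ⇔ e ∈E p
  ∈Eᵇ-reflects = ⇔-trans T-∨ (edgeEqᵇ-reflects ⊎-⇔ edgeEqᵇ-reflects)

  _∈E?_ : (e : Fin n × Fin n) (p : P2 n) → Dec (e ∈E p)
  e ∈E? p = Dec.map (∈Eᵇ-reflects {e} {p}) (T? (e ∈Eᵇ p))

  ∈Eᵇ⇒∈E : (e : Fin n × Fin n) (p : P2 n) → T (e ∈Eᵇ p) → e ∈E p
  ∈Eᵇ⇒∈E e p = Equivalence.to (∈Eᵇ-reflects {e} {p})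

  ∈E⇒∈Eᵇ : (e : Fin n × Fin n) (p : P2 n) → e ∈E p → T (e ∈Eᵇ p)
  ∈E⇒∈Eᵇ e p = Equivalence.from (∈Eᵇ-reflects {e} {p})

  EdgeEq-sym : {e f : Fin n × Fin n} → EdgeEq e f → EdgeEq f e
  EdgeEq-sym (inj₁ (refl , refl)) = inj₁ (refl , refl)
  EdgeEq-sym (inj₂ (refl , refl)) = inj₂ (refl , refl)

  EdgeEq-flip : {e : Fin n × Fin n} {u v : Fin n} → EdgeEq e (u , v) → EdgeEq e (v , u)
  EdgeEq-flip (inj₁ e≈) = inj₂ e≈
  EdgeEq-flip (inj₂ e≈) = inj₁ e≈

  ∈E-swap : {u v : Fin n} {p : P2 n} → (u , v) ∈E p → (v , u) ∈E p
  ∈E-swap (inj₁ (inj₁ (refl , refl))) = inj₁ (inj₂ (refl , refl))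
  ∈E-swap (inj₁ (inj₂ (refl , refl))) = inj₁ (inj₁ (refl , refl))
  ∈E-swap (inj₂ (inj₁ (refl , refl))) = inj₂ (inj₂ (refl , refl))
  ∈E-swap (inj₂ (inj₂ (refl , refl))) = inj₂ (inj₁ (refl , refl))

  ∈E-resp : {e f : Fin n × Fin n} {p : P2 n} → EdgeEq e f → e ∈E p → f ∈E p
  ∈E-resp (inj₁ (refl , refl)) e∈p = e∈p
  ∈E-resp (inj₂ (refl , refl)) e∈p = ∈E-swap e∈p

  ∈E-middle : {x y : Fin n} {p : P2 n} → (x , y) ∈E p → x ≡ v₂ p ⊎ y ≡ v₂ p
  ∈E-middle (inj₁ (inj₁ (_ , y≡))) = inj₂ y≡
  ∈E-middle (inj₁ (inj₂ (x≡ , _))) = inj₁ x≡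
  ∈E-middle (inj₂ (inj₁ (x≡ , _))) = inj₁ x≡
  ∈E-middle (inj₂ (inj₂ (_ , y≡))) = inj₂ y≡

  ∈E⇒∈V : {x y : Fin n} {p : P2 n} → (x , y) ∈E p → x ∈V p
  ∈E⇒∈V (inj₁ (inj₁ (x≡ , _))) = inj₁ x≡
  ∈E⇒∈V (inj₁ (inj₂ (x≡ , _))) = inj₂ (inj₁ x≡)
  ∈E⇒∈V (inj₂ (inj₁ (x≡ , _))) = inj₂ (inj₁ x≡)
  ∈E⇒∈V (inj₂ (inj₂ (x≡ , _))) = inj₂ (inj₂ x≡)

  Consecutive : Fin 3 → Fin 3 → Set
  Consecutive s t = (toℕ t ≡ suc (toℕ s)) ⊎ (suc (toℕ t) ≡ toℕ s)

  consecutive-edge : (p : P2 n) (s t : Fin 3) → Consecutive s t → (vtx p t , vtx p s) ∈E p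
  consecutive-edge p zero (suc zero) _ = inj₁ (inj₂ (refl , refl))
  consecutive-edge p (suc zero) zero _ = inj₁ (inj₁ (refl , refl))
  consecutive-edge p (suc zero) (suc (suc zero)) _ = inj₂ (inj₂ (refl , refl))
  consecutive-edge p (suc (suc zero)) (suc zero) _ = inj₂ (inj₁ (refl , refl))
  consecutive-edge p zero zero (inj₁ ())
  consecutive-edge p zero zero (inj₂ ())
  consecutive-edge p zero (suc (suc zero)) (inj₁ ())
  consecutive-edge p zero (suc (suc zero)) (inj₂ ())
  consecutive-edge p (suc zero) (suc zero) (inj₁ ())
  consecutive-edge p (suc zero) (suc zero) (inj₂ ())
  consecutive-edge p (suc (suc zero)) zero (inj₁ ())
  consecutive-edge p (suc (suc zero)) zero (inj₂ ())
  consecutive-edge p (suc (suc zero)) (suc (suc zero)) (inj₁ ())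
  consecutive-edge p (suc (suc zero)) (suc (suc zero)) (inj₂ ())

  shiftable⇒free-neighbour : {Q : List (P2 n)} {q p : P2 n} {x : Fin n} → ShiftableAt Q q p x →
    Σ (Fin n) λ y → ((y , x) ∈E p) × (y ∉VS Q)
  shiftable⇒free-neighbour {p = p} (_ , s , s≡x , inj₁ (t , st , t-free)) =
    vtx p t , subst (λ z → (vtx p t , z) ∈E p) s≡x (consecutive-edge p s t (inj₁ st)) , t-free
  shiftable⇒free-neighbour {p = p} (_ , s , s≡x , inj₂ (t , ts , t-free)) =
    vtx p t , subst (λ z → (vtx p t , z) ∈E p) s≡x (consecutive-edge p s t (inj₂ ts)) , t-free

  edges⊆E : (p : P2 n) {e : Fin n × Fin n} → e ∈ edges p → e ∈E p
  edges⊆E p (here refl) = inj₁ (inj₁ (refl , refl))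
  edges⊆E p (there (here refl)) = inj₂ (inj₁ (refl , refl))

  E⊆edges : (p : P2 n) {e : Fin n × Fin n} → e ∈E p → Σ (Fin n × Fin n) λ f → (f ∈ edges p) × EdgeEq e f
  E⊆edges p (inj₁ e≈) = _ , here refl , e≈
  E⊆edges p (inj₂ e≈) = _ , there (here refl) , e≈

  ∈Eᵇ-gain : (p q q' : P2 n) → (∀ {e} → e ∈E p → e ∈E q → e ∈E q') →
             ∀ {e} → e ∈ edges p → T (e ∈Eᵇ q) → T (e ∈Eᵇ q')
  ∈Eᵇ-gain p q q' gain {e} e∈edges = ∈E⇒∈Eᵇ e q' ∘ gain (edges⊆E p e∈edges) ∘ ∈Eᵇ⇒∈E e q

  commonEdges-mono : (p q q' : P2 n) → (∀ {e} → e ∈E p → e ∈E q → e ∈E q') →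
                     commonEdges p q ≤ commonEdges p q'
  commonEdges-mono p q q' gain = count-mono (_∈Eᵇ q) (_∈Eᵇ q') (edges p) (∈Eᵇ-gain p q q' gain)

  commonEdges-strict : (p q q' : P2 n) → (∀ {e} → e ∈E p → e ∈E q → e ∈E q') →
                       ∀ {e} → e ∈E p → ¬ e ∈E q → e ∈E q' → commonEdges p q < commonEdges p q'
  commonEdges-strict p q q' gain e∈p e∉q e∈q' with E⊆edges p e∈p
  ... | f , f∈edges , e≈f =
    count-strict (_∈Eᵇ q) (_∈Eᵇ q') (edges p) (∈Eᵇ-gain p q q' gain) f∈edges
      (e∉q ∘ ∈E-resp (EdgeEq-sym e≈f) ∘ ∈Eᵇ⇒∈E f q) (∈E⇒∈Eᵇ f q' (∈E-resp e≈f e∈q'))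

  sameEdges-zero : (p q : P2 n) {e : Fin n × Fin n} → e ∈E q → ¬ e ∈E p → sameEdges p q ≡ 0
  sameEdges-zero p q e∈q e∉p with E⊆edges q e∈q
  ... | f , f∈edges , e≈f = indicator-zero λ equal →
    e∉p (∈E-resp (EdgeEq-sym e≈f)
      (∈Eᵇ⇒∈E f p (allᵇ-lookup (_∈Eᵇ p) (edges q) (proj₂ (Equivalence.to (T-∧ {E[p]⊆E[q]}) equal)) f∈edges)))
    where
    E[p]⊆E[q] : Bool
    E[p]⊆E[q] = allᵇ (_∈Eᵇ q) (edges p)

  double-sum-∷=-mono : (f : P2 n → P2 n → ℕ) (P Q : List (P2 n)) {q : P2 n} (q∈Q : q ∈ Q) (q' : P2 n) →
    (∀ {p} → p ∈ P → f p q ≤ f p q') → double-sum f P Q ≤ double-sum f P (q∈Q ∷= q')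
  double-sum-∷=-mono f P Q q∈Q q' grow =
    sum-mono _ _ P (λ {p} p∈P → sum-∷=-mono (f p) Q q∈Q q' (grow p∈P))

  double-sum-∷=-strict : (f : P2 n → P2 n → ℕ) (P Q : List (P2 n)) {q : P2 n} (q∈Q : q ∈ Q) (q' : P2 n) →
    (∀ {p} → p ∈ P → f p q ≤ f p q') → ∀ {p} → p ∈ P → f p q < f p q' →
    double-sum f P Q < double-sum f P (q∈Q ∷= q')
  double-sum-∷=-strict f P Q q∈Q q' grow {p} p∈P grow-p =
    sum-strict _ _ P (λ {p} p∈P → sum-∷=-mono (f p) Q q∈Q q' (grow p∈P)) p∈P
      (sum-∷=-strict (f p) Q q∈Q q' grow-p)

  Disjoint-sym : {p q : P2 n} → Disjoint p q → Disjoint q p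
  Disjoint-sym p#q x x∈q x∈p = p#q x x∈p x∈q

  reverse : P2 n → P2 n
  reverse p = ⟨ v₃ p , v₂ p , v₁ p ⟩

  _≃_ : P2 n → P2 n → Set
  r ≃ q = (r ≡ q) ⊎ (r ≡ reverse q)

  ≃-∈V : {r q : P2 n} {x : Fin n} → r ≃ q → x ∈V r → x ∈V q
  ≃-∈V (inj₁ refl) x∈r = x∈r
  ≃-∈V (inj₂ refl) (inj₁ x≡) = inj₂ (inj₂ x≡)
  ≃-∈V (inj₂ refl) (inj₂ (inj₁ x≡)) = inj₂ (inj₁ x≡)
  ≃-∈V (inj₂ refl) (inj₂ (inj₂ x≡)) = inj₁ x≡

  reverse-∈E : {p : P2 n} {e : Fin n × Fin n} → e ∈E p → e ∈E reverse p
  reverse-∈E (inj₁ e≈) = inj₂ (EdgeEq-flip e≈)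
  reverse-∈E (inj₂ e≈) = inj₁ (EdgeEq-flip e≈)

  ≃-∈E : {r q : P2 n} {e : Fin n × Fin n} → r ≃ q → e ∈E q → e ∈E r
  ≃-∈E (inj₁ refl) e∈q = e∈q
  ≃-∈E (inj₂ refl) e∈q = reverse-∈E e∈q

  ≃-∈E⁻ : {r q : P2 n} {e : Fin n × Fin n} → r ≃ q → e ∈E r → e ∈E q
  ≃-∈E⁻ (inj₁ refl) e∈r = e∈r
  ≃-∈E⁻ {q = q} (inj₂ refl) e∈r = reverse-∈E {p = reverse q} e∈r

module _ {n : ℕ} (G : Graph n) where

  ≃-IsP2 : {r q : P2 n} → r ≃ q → IsP2 G q → IsP2 G r
  ≃-IsP2 (inj₁ refl) q-path = q-path
  ≃-IsP2 (inj₂ refl) (d₁₂ , d₂₃ , d₁₃ , a₁₂ , a₂₃) =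
    d₂₃ ∘ sym , d₁₂ ∘ sym , d₁₃ ∘ sym , Graph.sym G a₂₃ , Graph.sym G a₁₂

  ∈E⇒Adj : {p : P2 n} → IsP2 G p → {x y : Fin n} → (x , y) ∈E p → Adj G x y
  ∈E⇒Adj (_ , _ , _ , a₁₂ , _) (inj₁ (inj₁ (refl , refl))) = a₁₂
  ∈E⇒Adj (_ , _ , _ , a₁₂ , _) (inj₁ (inj₂ (refl , refl))) = Graph.sym G a₁₂
  ∈E⇒Adj (_ , _ , _ , _ , a₂₃) (inj₂ (inj₁ (refl , refl))) = a₂₃
  ∈E⇒Adj (_ , _ , _ , _ , a₂₃) (inj₂ (inj₂ (refl , refl))) = Graph.sym G a₂₃

  packing-∷= : (Q : List (P2 n)) → IsPacking G Q → {q : P2 n} (q∈Q : q ∈ Q) {q' : P2 n} →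
    IsP2 G q' → (∀ {x} → x ∈V q' → x ∈V q ⊎ x ∉VS Q) → IsPacking G (q∈Q ∷= q')
  packing-∷= Q (paths , disjoint) {q} q∈Q {q'} q'-path q'-vertices =
    All-∷= Q q∈Q q' paths q'-path ,
    AllPairs-∷= Q q∈Q q' disjoint stays-disjoint (λ r∈Q → Disjoint-sym ∘ stays-disjoint r∈Q ∘ Disjoint-sym)
    where
    stays-disjoint : ∀ {r} → r ∈ Q → Disjoint r q → Disjoint r q'
    stays-disjoint {r} r∈Q r#q x x∈r x∈q' with q'-vertices x∈q'
    ... | inj₁ x∈q = r#q x x∈r x∈q
    ... | inj₂ x-unused = x-unused (r , r∈Q , x∈r)

  𝔔₂-no-improving-replacement : {P Q : List (P2 n)} {j : ℕ} → InQ2 G P j Q →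
    {q : P2 n} (q∈Q : q ∈ Q) {q' : P2 n} → IsP2 G q' → (∀ {x} → x ∈V q' → x ∈V q ⊎ x ∉VS Q) →
    (∀ {p} → p ∈ P → sameEdges p q ≤ sameEdges p q') →
    (∀ {p} → p ∈ P → commonEdges p q ≤ commonEdges p q') →
    {p : P2 n} → p ∈ P → ¬ (commonEdges p q < commonEdges p q')
  𝔔₂-no-improving-replacement {P} {Q} {j} ((Q-packing , Q-size , Q-max₁) , Q-max₂) q∈Q {q'}
    q'-path q'-vertices same≤ common≤ p∈P common< = <⇒≱ score₂-grows (Q-max₂ Q' Q'∈𝔔₁)
    where
    Q' : List (P2 n)
    Q' = q∈Q ∷= q'

    score₁-grows : score₁ P Q ≤ score₁ P Q'
    score₁-grows = double-sum-∷=-mono sameEdges P Q q∈Q q' same≤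

    Q'∈𝔔₁ : InQ1 G P j Q'
    Q'∈𝔔₁ = packing-∷= Q Q-packing q∈Q q'-path q'-vertices ,
            trans (length-∷= Q _ q') Q-size ,
            λ Q'' packing size → ≤-trans (Q-max₁ Q'' packing size) score₁-grows

    score₂-grows : score₂ P Q < score₂ P Q'
    score₂-grows = double-sum-∷=-strict commonEdges P Q q∈Q q' common≤ p∈P common<

  -- If the first vertex a of a P₂ r = abc has a neighbour y ∉ V(r) on p, then
  -- {c,b} ∉ E(p): the middle vertex of p is a or y, while b, c ∉ {a, y}.
  far-edge-not-in : {r p : P2 n} → IsP2 G r → {y : Fin n} → (y , v₁ r) ∈E p → ¬ y ∈V r →
                    ¬ (v₃ r , v₂ r) ∈E p
  far-edge-not-in (a≢b , _ , a≢c , _) ya∈p y∉r cb∈p with ∈E-middle cb∈p | ∈E-middle ya∈p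
  ... | inj₁ c≡m | inj₁ y≡m = y∉r (inj₂ (inj₂ (trans y≡m (sym c≡m))))
  ... | inj₁ c≡m | inj₂ a≡m = a≢c (trans a≡m (sym c≡m))
  ... | inj₂ b≡m | inj₁ y≡m = y∉r (inj₂ (inj₁ (trans y≡m (sym b≡m))))
  ... | inj₂ b≡m | inj₂ a≡m = a≢b (trans a≡m (sym b≡m))

  shift-impossible : {P Q : List (P2 n)} {j : ℕ} → InQ2 G P j Q →
    {q p r : P2 n} → q ∈ Q → p ∈ P → IsP2 G p → r ≃ q → IsP2 G r →
    {y : Fin n} → (y , v₁ r) ∈E p → y ∉VS Q →
    ¬ (∀ {p'} → p' ∈ P → ¬ (v₃ r , v₂ r) ∈E p')
  shift-impossible {P} {Q} Q∈𝔔₂ {q} {p} {r} q∈Q p∈P p-path r≃q (a≢b , _ , _ , ab , _) {y} ya∈p y-unused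
    no-cb =
    𝔔₂-no-improving-replacement Q∈𝔔₂ q∈Q q'-path q'-vertices same≤ common≤ p∈P
      (commonEdges-strict p q q' (shifted-keeps p∈P) ya∈p (y∉q ∘ ∈E⇒∈V) (inj₁ (inj₁ (refl , refl))))
    where
    q' : P2 n
    q' = ⟨ y , v₁ r , v₂ r ⟩

    y∉q : ¬ y ∈V q
    y∉q y∈q = y-unused (q , q∈Q , y∈q)

    q'-path : IsP2 G q'
    q'-path = y∉q ∘ ≃-∈V r≃q ∘ inj₁ , a≢b , y∉q ∘ ≃-∈V r≃q ∘ inj₂ ∘ inj₁ , ∈E⇒Adj p-path ya∈p , ab

    q'-vertices : ∀ {x} → x ∈V q' → x ∈V q ⊎ x ∉VS Q
    q'-vertices (inj₁ refl) = inj₂ y-unused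
    q'-vertices (inj₂ (inj₁ refl)) = inj₁ (≃-∈V r≃q (inj₁ refl))
    q'-vertices (inj₂ (inj₂ refl)) = inj₁ (≃-∈V r≃q (inj₂ (inj₁ refl)))

    same≤ : ∀ {p'} → p' ∈ P → sameEdges p' q ≤ sameEdges p' q'
    same≤ {p'} p'∈P =
      ≤-trans (≤-reflexive (sameEdges-zero p' q (≃-∈E⁻ r≃q (inj₂ (inj₂ (refl , refl)))) (no-cb p'∈P))) z≤n

    -- an edge of E(q) in some p' ∈ 𝒫 must be {a,b}, which q' keeps
    shifted-keeps : ∀ {p'} → p' ∈ P → ∀ {e} → e ∈E p' → e ∈E q → e ∈E q'
    shifted-keeps p'∈P e∈p' e∈q with ≃-∈E r≃q e∈q
    ... | inj₁ e≈ab = inj₂ e≈ab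
    ... | inj₂ e≈bc = ⊥-elim (no-cb p'∈P (∈E-swap (∈E-resp e≈bc e∈p')))

    common≤ : ∀ {p'} → p' ∈ P → commonEdges p' q ≤ commonEdges p' q'
    common≤ {p'} p'∈P = commonEdges-mono p' q q' (shifted-keeps p'∈P)

  shift-lemma : {P Q : List (P2 n)} {j : ℕ} → InQ2 G P j Q →
    {q p r : P2 n} → q ∈ Q → p ∈ P → IsP2 G p → r ≃ q →
    {y : Fin n} → (y , v₁ r) ∈E p → y ∉VS Q →
    Σ (P2 n) λ p' → (p' ∈ P) × (p' ≢ p) × ((v₃ r , v₂ r) ∈E p')
  shift-lemma {P} Q∈𝔔₂ {q} {p} {r} q∈Q p∈P p-path r≃q {y} ya∈p y-unused =
    decide (any? (λ p' → (v₃ r , v₂ r) ∈E? p') P)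
    where
    r-path : IsP2 G r
    r-path = ≃-IsP2 r≃q (All.lookup (proj₁ (proj₁ (proj₁ Q∈𝔔₂))) q∈Q)

    decide : Dec (Any (λ p' → (v₃ r , v₂ r) ∈E p') P) →
             Σ (P2 n) λ p' → (p' ∈ P) × (p' ≢ p) × ((v₃ r , v₂ r) ∈E p')
    decide (yes found) with find found
    ... | p' , p'∈P , cb∈p' =
      p' , p'∈P , (λ { refl → far-edge-not-in r-path ya∈p (λ y∈r → y-unused (q , q∈Q , ≃-∈V r≃q y∈r)) cb∈p' }) , cb∈p'
    decide (no none) =
      ⊥-elim (shift-impossible Q∈𝔔₂ q∈Q p∈P p-path r≃q r-path ya∈p y-unused (λ p'∈P → none ∘ lose p'∈P))

lemma6 : ∀ {n} (G : Graph n) (P : List (P2 n)) (j : ℕ) →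
    IsMaximalPacking G P → length P ≡ j →
    (Σ (List (P2 n)) λ Q₀ → IsPacking G Q₀ × length Q₀ ≡ suc j) →
    (Q : List (P2 n)) → InQ2 G P j Q →
    (q p : P2 n) → q ∈ Q → p ∈ P →
    (ShiftableAt Q q p (v₁ q) →
       Σ (P2 n) λ p' → (p' ∈ P) × (p' ≢ p) × ((v₃ q , v₂ q) ∈E p'))
    × (ShiftableAt Q q p (v₃ q) →
       Σ (P2 n) λ p' → (p' ∈ P) × (p' ≢ p) × ((v₂ q , v₁ q) ∈E p'))
lemma6 {n} G P j ((P-paths , _) , _) _ _ Q Q∈𝔔₂ q p q∈Q p∈P =
  shift-along q (inj₁ refl) ,
  λ shiftable → swap-edge (shift-along (reverse q) (inj₂ refl) shiftable)
  where
  -- shiftability of q with respect to v₃ q is shiftability of reverse q w.r.t. its v₁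
  shift-along : (r : P2 n) → r ≃ q → ShiftableAt Q q p (v₁ r) →
                Σ (P2 n) λ p' → (p' ∈ P) × (p' ≢ p) × ((v₃ r , v₂ r) ∈E p')
  shift-along r r≃q shiftable with shiftable⇒free-neighbour shiftable
  ... | y , ya∈p , y-unused =
    shift-lemma G Q∈𝔔₂ q∈Q p∈P (All.lookup P-paths p∈P) r≃q ya∈p y-unused

  swap-edge : (Σ (P2 n) λ p' → (p' ∈ P) × (p' ≢ p) × ((v₁ q , v₂ q) ∈E p')) →
              Σ (P2 n) λ p' → (p' ∈ P) × (p' ≢ p) × ((v₂ q , v₁ q) ∈E p')
  swap-edge (p' , p'∈P , p'≢p , e∈p') = p' , p'∈P , p'≢p , ∈E-swap e∈p'
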